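{- For every $n\ge 1$, the number of permutations in $\mathfrak S_n$ that avoid both the pattern $2\text{ - }1\text{ - }3$ and the barred pattern $\overline{2}\text{ - }31$ equals the Motzkin number $M_{n-1}$, where $\sum_{n\ge0}M_nt^n=\frac{1-t-\sqrt{1-2t-3t^2}}{2t^2}$.
   Context: $\mathfrak S_n$ is the set of permutations $\pi=\pi_1\pi_2\cdots\pi_n$ of $\{1,\dots,n\}$. A permutation $\pi$ avoids $2\text{ - }1\text{ - }3$ if there are no indices $i<j<k$ with $\pi_j<\pi_i<\pi_k$. A permutation $\pi$ avoids the barred pattern $\overline{2}\text{ - }31$ if for every index $i$ with $\pi_i>\pi_{i+1}$ there exists an index $j<i$ with $\pi_i>\pi_j>\pi_{i+1}$. -}

module Defs where

open import Data.Nat using (ℕ; zero; suc; _+_; _*_)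
open import Data.Fin using (Fin; toℕ; _<_)
open import Data.Vec using (Vec; lookup)
open import Data.List using (List; []; _∷_; zipWith; reverse)
open import Data.Nat.ListAction using (sum)
open import Data.Product using (_×_; ∃-syntax)
open import Relation.Nullary using (¬_)
open import Relation.Binary.PropositionalEquality using (_≡_)
open import Function.Definitions using (Injective)

-- A permutation π = π₁…πₙ of {1,…,n} is encoded (0-based) as a vector
-- of length n with entries in Fin n whose lookup map is injective.
IsPermutation : ∀ {n} → Vec (Fin n) n → Set
IsPermutation π = Injective _≡_ _≡_ (lookup π)

Avoids213 : ∀ {n} → Vec (Fin n) n → Set
Avoids213 {n} π = ∀ (i j k : Fin n) → i < j → j < k →
  ¬ (lookup π j < lookup π i × lookup π i < lookup π k)

AvoidsBar2-31 : ∀ {n} → Vec (Fin n) n → Set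
AvoidsBar2-31 {n} π = ∀ (i i' : Fin n) → toℕ i' ≡ suc (toℕ i) →
  lookup π i' < lookup π i →
  ∃[ j ] (j < i × lookup π j < lookup π i × lookup π i' < lookup π j)

-- Motzkin numbers, defined by the recurrence equivalent to
-- M(t) = 1 + t M(t) + t² M(t)², i.e. the generating function
-- (1 - t - sqrt(1 - 2t - 3t²)) / (2t²):
--   M₀ = 1,  M_{n+1} = M_n + Σ_{k=0}^{n-1} M_k M_{n-1-k}.
-- motzkinList n = [M_n, M_{n-1}, …, M_0].
motzkinList : ℕ → List ℕ
motzkinList zero = 1 ∷ []
motzkinList (suc n) with motzkinList n
... | [] = []
... | m ∷ rest = (m + sum (zipWith _*_ rest (reverse rest))) ∷ m ∷ rest

motzkin : ℕ → ℕ
motzkin n with motzkinList n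
... | [] = 0
... | m ∷ _ = m

module Submission where

-- Counted permutations of {0,…,n} (avoiding 2-1-3 and 2̄-31) decompose uniquely as
--   a · (σ shifted above a) · τ,
-- with σ, τ counted permutations of {0,…,n-a-1} and {0,…,a-1}: the entries after the first
-- letter a that exceed a come first (a later larger entry would complete a 2-1-3 with a),
-- and a < n unless n = 0 (the descent from a into τ needs a witness from σ). Conversely every
-- such list is counted. Hence with c_k counted permutations of size k, c_{n+1} = c_n +
-- Σ_{1≤a<n} c_{n-a} c_a, the Motzkin recurrence, and c_{n+1} = M_n.

open import Defs
open import Data.Nat using (ℕ; _≤_; _∸_)
open import Data.Fin using (Fin)
open import Data.Vec using (Vec)
open import Data.List using (List; length)
open import Data.List.Membership.Propositional using (_∈_)
open import Data.List.Relation.Unary.Unique.Propositional using (Unique)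
open import Data.Product using (Σ; _×_)
open import Function.Bundles using (_⇔_)
open import Relation.Binary.PropositionalEquality using (_≡_)

open import Data.Nat using (zero; suc; _+_; _*_; _<_; z≤n; s≤s; _<?_)
open import Data.Nat.Properties
open import Data.Nat.ListAction using (sum)
open import Data.Nat.DivMod using (_mod_; m<n⇒m%n≡m)
import Data.Fin as Fin
open import Data.Fin using (toℕ)
open import Data.Fin.Properties using (toℕ-injective; toℕ<n; toℕ-fromℕ<)
import Data.Fin.Properties as FinP
open import Data.Vec using ([]; _∷_; lookup; toList)
open import Data.Vec.Properties using (length-toList)
open import Data.List
  using ([]; _∷_; _++_; _ʳ++_; map; filter; concatMap; cartesianProductWith;
         upTo; applyUpTo; downFrom; applyDownFrom; zipWith; reverse)
open import Data.List.Properties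
  using (length-map; length-++; ++-cancelˡ; map-injective; map-cong; ∷-injectiveˡ; ∷-injectiveʳ;
         filter-all; filter-accept; filter-reject; map-upTo; map-downFrom; reverse-map; reverse-downFrom)
open import Data.List.Relation.Unary.All as All using (All; []; _∷_)
import Data.List.Relation.Unary.All.Properties as AllP
open import Data.List.Relation.Unary.Any as Any using (Any; here; there)
import Data.List.Relation.Unary.Any.Properties as AnyP
open import Data.List.Relation.Unary.AllPairs using ([]; _∷_)
import Data.List.Relation.Unary.Unique.Propositional.Properties as UniqueP
open import Data.List.Membership.Propositional using (find; lose)
open import Data.List.Membership.Propositional.Properties
  using (∈-map⁺; ∈-map⁻; ∈-upTo⁺; ∈-upTo⁻; ∈-concatMap⁺; ∈-concatMap⁻;
         ∈-cartesianProductWith⁺; ∈-cartesianProductWith⁻)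
open import Data.List.Relation.Binary.Subset.Propositional using (_⊆_)
open import Data.List.Relation.Binary.Subset.Propositional.Properties using (Any-resp-⊆)
open import Data.Product using (_,_; proj₁; proj₂; ∃-syntax)
open import Data.Sum using (_⊎_; inj₁; inj₂; [_,_]′)
open import Data.Unit using (⊤; tt)
open import Data.Empty using (⊥-elim)
open import Function using (id)
open import Function.Definitions using (Injective)
open import Function.Bundles using (mk⇔; Equivalence)
open import Relation.Nullary using (¬_; yes; no)
open import Relation.Binary.PropositionalEquality
  using (_≢_; refl; sym; trans; cong; cong₂; subst; module ≡-Reasoning)

PermList : ℕ → List ℕ → Set
PermList n l = length l ≡ n × All (_< n) l × Unique l

length≡0⇒[] : ∀ {l : List ℕ} → length l ≡ 0 → l ≡ []
length≡0⇒[] {[]} _ = refl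

length-filter-below : ∀ k l → Unique l → All (_< suc k) l →
  length l ≤ suc (length (filter (_<? k) l))
length-filter-below k [] _ _ = z≤n
length-filter-below k (x ∷ l) (x∉l ∷ l-unique) (x<1+k ∷ l<1+k) with x <? k
... | yes x<k = subst (λ l' → suc (length l) ≤ suc (length l')) (sym (filter-accept (_<? k) x<k))
                    (s≤s (length-filter-below k l l-unique l<1+k))
... | no x≮k = s≤s (≤-reflexive (cong length (sym (trans (filter-reject (_<? k) x≮k) (filter-all (_<? k) l<k)))))
  where
  x≡k : x ≡ k
  x≡k = ≤-antisym (≤-pred x<1+k) (≮⇒≥ x≮k)
  l<k : All (_< k) l
  l<k = All.zipWith (λ (x≢y , y<1+k) → ≤∧≢⇒< (≤-pred y<1+k) (λ y≡k → x≢y (trans x≡k (sym y≡k))))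
                    (x∉l , l<1+k)

unique-bounded-length : ∀ m l → Unique l → All (_< m) l → length l ≤ m
unique-bounded-length zero [] _ _ = z≤n
unique-bounded-length zero (x ∷ l) _ (() ∷ _)
unique-bounded-length (suc k) l l-unique l<m =
  ≤-trans (length-filter-below k l l-unique l<m)
          (s≤s (unique-bounded-length k (filter (_<? k) l)
                  (UniqueP.filter⁺ (_<? k) l-unique) (AllP.all-filter (_<? k) l)))

+-squeeze : ∀ {x y p q} → x ≤ p → y ≤ q → x + y ≡ p + q → x ≡ p × y ≡ q
+-squeeze {x} {y} {p} {q} x≤p y≤q sum≡ = x≡p , y≡q
  where
  x≡p : x ≡ p
  x≡p = ≤-antisym x≤p (+-cancelʳ-≤ q p x (subst (_≤ x + q) sum≡ (+-monoʳ-≤ x y≤q)))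
  y≡q : y ≡ q
  y≡q = ≤-antisym y≤q (+-cancelˡ-≤ p q y (subst (p + q ≤_) (cong (_+ y) x≡p) (≤-reflexive (sym sum≡))))

unique-++⁻ : ∀ (xs {ys} : List ℕ) → Unique (xs ++ ys) → Unique xs × Unique ys
unique-++⁻ [] ys-unique = [] , ys-unique
unique-++⁻ (x ∷ xs) (x∉ ∷ rest) =
  let (xs-unique , ys-unique) = unique-++⁻ xs rest in (AllP.++⁻ˡ xs x∉ ∷ xs-unique) , ys-unique

-- `No213Over x l`: no entry y of l is followed later in l by an entry z with y < x < z;
-- that is, x ∷ l contains no occurrence of 2-1-3 in which x plays the role of the 2.
No213Over : ℕ → List ℕ → Set
No213Over x [] = ⊤
No213Over x (y ∷ l) = (y < x → All (λ z → ¬ x < z) l) × No213Over x l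

Avoids213ᴸ : List ℕ → Set
Avoids213ᴸ [] = ⊤
Avoids213ᴸ (x ∷ l) = No213Over x l × Avoids213ᴸ l

below⇒notAbove : ∀ {x l} → All (_< x) l → All (λ z → ¬ x < z) l
below⇒notAbove = All.map (λ z<x x<z → <-asym z<x x<z)

no213Over-above : ∀ x l → All (x <_) l → No213Over x l
no213Over-above x [] _ = tt
no213Over-above x (y ∷ l) (x<y ∷ l>x) = (λ y<x → ⊥-elim (<-asym x<y y<x)) , no213Over-above x l l>x

no213Over-++ : ∀ x l₁ l₂ → No213Over x l₁ → All (_< x) l₂ → No213Over x (l₁ ++ l₂)
no213Over-++ x [] [] _ _ = tt
no213Over-++ x [] (y ∷ l₂) _ (_ ∷ l₂<x) = (λ _ → below⇒notAbove l₂<x) , no213Over-++ x [] l₂ tt l₂<x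
no213Over-++ x (y ∷ l₁) l₂ (y-ok , l₁-ok) l₂<x =
  (λ y<x → AllP.++⁺ (y-ok y<x) (below⇒notAbove l₂<x)) , no213Over-++ x l₁ l₂ l₁-ok l₂<x

no213Over-++⁻ : ∀ x l₁ l₂ → No213Over x (l₁ ++ l₂) → No213Over x l₁ × No213Over x l₂
no213Over-++⁻ x [] l₂ ok = tt , ok
no213Over-++⁻ x (y ∷ l₁) l₂ (y-ok , rest) =
  let (l₁-ok , l₂-ok) = no213Over-++⁻ x l₁ l₂ rest
  in ((λ y<x → AllP.++⁻ˡ l₁ (y-ok y<x)) , l₁-ok) , l₂-ok

avoids213-++⁻ : ∀ l₁ l₂ → Avoids213ᴸ (l₁ ++ l₂) → Avoids213ᴸ l₁ × Avoids213ᴸ l₂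
avoids213-++⁻ [] l₂ av = tt , av
avoids213-++⁻ (x ∷ l₁) l₂ (x-ok , rest) =
  let (av₁ , av₂) = avoids213-++⁻ l₁ l₂ rest
  in (proj₁ (no213Over-++⁻ x l₁ l₂ x-ok) , av₁) , av₂

-- A 2-1-3-avoiding block of entries above a followed by one of entries below a avoids 2-1-3:
-- an occurrence cannot have its 2 in the upper block and its 1 and 3 in the lower one.
avoids213-++ : ∀ a l₁ l₂ → All (a <_) l₁ → All (_< a) l₂ →
  Avoids213ᴸ l₁ → Avoids213ᴸ l₂ → Avoids213ᴸ (l₁ ++ l₂)
avoids213-++ a [] l₂ _ _ _ av₂ = av₂
avoids213-++ a (x ∷ l₁) l₂ (a<x ∷ l₁>a) l₂<a (x-ok , av₁) av₂ =
  no213Over-++ x l₁ l₂ x-ok (All.map (λ z<a → <-trans z<a a<x) l₂<a) ,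
  avoids213-++ a l₁ l₂ l₁>a l₂<a av₁ av₂

Between : ℕ → ℕ → ℕ → Set
Between v u w = v < w × w < u

-- `Witnessed s l`: every descent u > v of adjacent entries of l has a value strictly between
-- v and u read before u, either in s (the letters preceding l, most recent first) or in l.
-- `Witnessed [] l` says that l avoids the barred pattern 2̄-31.
Witnessed : List ℕ → List ℕ → Set
Witnessed s [] = ⊤
Witnessed s (u ∷ []) = ⊤
Witnessed s (u ∷ v ∷ l) = (v < u → Any (Between v u) s) × Witnessed (u ∷ s) (v ∷ l)

Good : List ℕ → Set
Good l = Avoids213ᴸ l × Witnessed [] l

witnessed-weaken : ∀ {s t} l → s ⊆ t → Witnessed s l → Witnessed t l
witnessed-weaken [] _ _ = tt
witnessed-weaken (u ∷ []) _ _ = tt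
witnessed-weaken (u ∷ v ∷ l) s⊆t (descent , rest) =
  (λ v<u → Any-resp-⊆ s⊆t (descent v<u)) , witnessed-weaken (v ∷ l) u∷s⊆u∷t rest
  where
  u∷s⊆u∷t : _ ⊆ _
  u∷s⊆u∷t (here e) = here e
  u∷s⊆u∷t (there m) = there (s⊆t m)

witnessed-++⁻ : ∀ s l₁ l₂ → Witnessed s (l₁ ++ l₂) → Witnessed s l₁ × Witnessed (l₁ ʳ++ s) l₂
witnessed-++⁻ s [] l₂ w = tt , w
witnessed-++⁻ s (u ∷ []) [] w = tt , tt
witnessed-++⁻ s (u ∷ []) (v ∷ l₂) (_ , w) = tt , w
witnessed-++⁻ s (u ∷ v ∷ l₁) l₂ (descent , rest) =
  let (w₁ , w₂) = witnessed-++⁻ (u ∷ s) (v ∷ l₁) l₂ rest in (descent , w₁) , w₂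

Outside : List ℕ → List ℕ → Set
Outside t l = All (λ w → All (λ u → ¬ w < u) l ⊎ All (λ v → ¬ v < w) l) t

outside-tail : ∀ {t u l} → Outside t (u ∷ l) → Outside t l
outside-tail = All.map (λ { (inj₁ (_ ∷ above)) → inj₁ above ; (inj₂ (_ ∷ below)) → inj₂ below })

outside-no-witness : ∀ {t l u v} → Outside t l → v ∈ l → u ∈ l → ¬ Any (Between v u) t
outside-no-witness (inj₁ w-above ∷ _) _ u∈l (here (_ , w<u)) = All.lookup w-above u∈l w<u
outside-no-witness (inj₂ w-below ∷ _) v∈l _ (here (v<w , _)) = All.lookup w-below v∈l v<w
outside-no-witness (_ ∷ out) v∈l u∈l (there w) = outside-no-witness out v∈l u∈l w

witnessed-drop : ∀ s t l → Outside t l → Witnessed (s ++ t) l → Witnessed s l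
witnessed-drop s t [] _ _ = tt
witnessed-drop s t (u ∷ []) _ _ = tt
witnessed-drop s t (u ∷ v ∷ l) out (descent , rest) =
  (λ v<u → [ id , (λ w → ⊥-elim (outside-no-witness out (there (here refl)) (here refl) w)) ]′
             (AnyP.++⁻ s (descent v<u))) ,
  witnessed-drop (u ∷ s) t (v ∷ l) (outside-tail out) rest

-- Joining x ∷ l₁ (above w) with l₂ (below w), where w has already been read: the only new
-- descent, from the last entry of x ∷ l₁ to the first of l₂, is witnessed by w.
witnessed-join : ∀ s x l₁ l₂ w → w ∈ s → All (w <_) (x ∷ l₁) → All (_< w) l₂ →
  Witnessed s (x ∷ l₁) → Witnessed [] l₂ → Witnessed s (x ∷ l₁ ++ l₂)
witnessed-join s x [] [] w _ _ _ _ _ = tt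
witnessed-join s x [] (v ∷ l₂) w w∈s (w<x ∷ []) (v<w ∷ _) _ w₂ =
  (λ _ → Any.map (λ { refl → v<w , w<x }) w∈s) , witnessed-weaken (v ∷ l₂) (λ ()) w₂
witnessed-join s x (y ∷ l₁) l₂ w w∈s (_ ∷ l₁>w) l₂<w (descent , w₁) w₂ =
  descent , witnessed-join (x ∷ s) y l₁ l₂ w (there w∈s) l₁>w l₂<w w₁ w₂

-- Both patterns only compare entries, so they are preserved and reflected by any strictly
-- monotone relabelling f of the values.
module OrderEmbedding (f : ℕ → ℕ) (f-mono : ∀ {x y} → x < y → f x < f y)
                      (f-reflects : ∀ {x y} → f x < f y → x < y) where

  no213Over⁺ : ∀ x l → No213Over x l → No213Over (f x) (map f l)
  no213Over⁺ x [] _ = tt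
  no213Over⁺ x (y ∷ l) (y-ok , rest) =
    (λ fy<fx → AllP.map⁺ (All.map (λ ¬x<z fx<fz → ¬x<z (f-reflects fx<fz)) (y-ok (f-reflects fy<fx)))) ,
    no213Over⁺ x l rest

  no213Over⁻ : ∀ x l → No213Over (f x) (map f l) → No213Over x l
  no213Over⁻ x [] _ = tt
  no213Over⁻ x (y ∷ l) (y-ok , rest) =
    (λ y<x → All.map (λ ¬fx<fz x<z → ¬fx<fz (f-mono x<z)) (AllP.map⁻ (y-ok (f-mono y<x)))) ,
    no213Over⁻ x l rest

  avoids213⁺ : ∀ l → Avoids213ᴸ l → Avoids213ᴸ (map f l)
  avoids213⁺ [] _ = tt
  avoids213⁺ (x ∷ l) (x-ok , rest) = no213Over⁺ x l x-ok , avoids213⁺ l rest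

  avoids213⁻ : ∀ l → Avoids213ᴸ (map f l) → Avoids213ᴸ l
  avoids213⁻ [] _ = tt
  avoids213⁻ (x ∷ l) (x-ok , rest) = no213Over⁻ x l x-ok , avoids213⁻ l rest

  witnessed⁺ : ∀ s l → Witnessed s l → Witnessed (map f s) (map f l)
  witnessed⁺ s [] _ = tt
  witnessed⁺ s (u ∷ []) _ = tt
  witnessed⁺ s (u ∷ v ∷ l) (descent , rest) =
    (λ fv<fu → AnyP.map⁺ (Any.map (λ (v<w , w<u) → f-mono v<w , f-mono w<u) (descent (f-reflects fv<fu)))) ,
    witnessed⁺ (u ∷ s) (v ∷ l) rest

  witnessed⁻ : ∀ s l → Witnessed (map f s) (map f l) → Witnessed s l
  witnessed⁻ s [] _ = tt
  witnessed⁻ s (u ∷ []) _ = tt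
  witnessed⁻ s (u ∷ v ∷ l) (descent , rest) =
    (λ v<u → Any.map (λ (fv<fw , fw<fu) → f-reflects fv<fw , f-reflects fw<fu) (AnyP.map⁻ (descent (f-mono v<u)))) ,
    witnessed⁻ (u ∷ s) (v ∷ l) rest

shift : ℕ → List ℕ → List ℕ
shift a = map (suc a +_)

module Shift (a : ℕ) = OrderEmbedding (suc a +_) (+-monoʳ-< (suc a)) (λ {x} {y} → +-cancelˡ-< (suc a) x y)

shift-above : ∀ a σ → All (a <_) (shift a σ)
shift-above a [] = []
shift-above a (y ∷ σ) = s≤s (m≤m+n a y) ∷ shift-above a σ

unshift : ∀ a σ' → All (a <_) σ' → Σ (List ℕ) λ σ → σ' ≡ shift a σ
unshift a [] _ = [] , refl
unshift a (x ∷ σ') (a<x ∷ σ'>a) =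
  let (σ , σ'≡) = unshift a σ' σ'>a in (x ∸ suc a) ∷ σ , cong₂ _∷_ (sym (m+[n∸m]≡n a<x)) σ'≡

-- The shape of every counted permutation: first letter a, then a block of larger values,
-- then a block of smaller values.
assemble : ℕ → List ℕ → List ℕ → List ℕ
assemble a σ τ = a ∷ shift a σ ++ τ

-- The possible first letters of a counted permutation of {0,…,n}: a < n, or a = 0 when n = 0.
-- (A first letter a = n > 0 would start a descent with nothing read before it.)
firstLetters : ℕ → List ℕ
firstLetters zero = 0 ∷ []
firstLetters (suc m) = upTo (suc m)

firstLetters-unique : ∀ n → Unique (firstLetters n)
firstLetters-unique zero = [] ∷ []
firstLetters-unique (suc m) = UniqueP.upTo⁺ (suc m)

firstLetters-sound : ∀ {n a} → a ∈ firstLetters n → a ≤ n × (n ∸ a ≡ 0 → a ≡ 0)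
firstLetters-sound {zero} (here refl) = z≤n , λ _ → refl
firstLetters-sound {suc m} a∈ = <⇒≤ (∈-upTo⁻ a∈) , λ n∸a≡0 → ⊥-elim (m>n⇒m∸n≢0 (∈-upTo⁻ a∈) n∸a≡0)

firstLetters-complete : ∀ {n a} → a ≤ n → (n ∸ a ≡ 0 → a ≡ 0) → a ∈ firstLetters n
firstLetters-complete {zero} {zero} _ _ = here refl
firstLetters-complete {suc m} a≤n forced with m≤n⇒m<n∨m≡n a≤n
... | inj₁ a<n = ∈-upTo⁺ a<n
... | inj₂ refl = ⊥-elim (1+n≢0 (forced (n∸n≡0 (suc m))))

record Decomposition (n : ℕ) (l : List ℕ) : Set where
  constructor decomposition
  field
    a : ℕ
    σ τ : List ℕ
    admissible : a ∈ firstLetters n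
    σ-perm : PermList (n ∸ a) σ
    σ-good : Good σ
    τ-perm : PermList a τ
    τ-good : Good τ
    l≡ : l ≡ assemble a σ τ

assemble-perm : ∀ {n a σ τ} → a ≤ n → PermList (n ∸ a) σ → PermList a τ →
  PermList (suc n) (assemble a σ τ)
assemble-perm {n} {a} {σ} {τ} a≤n (|σ| , σ<n∸a , σ-unique) (|τ| , τ<a , τ-unique) =
  cong suc length≡ ,
  (s≤s a≤n ∷ AllP.++⁺ (AllP.map⁺ (All.map shifted-bound σ<n∸a)) (All.map (λ y<a → <-trans y<a (s≤s a≤n)) τ<a)) ,
  (AllP.++⁺ (All.map <⇒≢ (shift-above a σ)) (All.map >⇒≢ τ<a) ∷
   UniqueP.++⁺ (UniqueP.map⁺ (+-cancelˡ-≡ (suc a) _ _) σ-unique) τ-unique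
     (λ (y∈σ' , y∈τ) → <-asym (All.lookup (shift-above a σ) y∈σ') (All.lookup τ<a y∈τ)))
  where
  open ≡-Reasoning
  length≡ : length (shift a σ ++ τ) ≡ n
  length≡ = begin
    length (shift a σ ++ τ)        ≡⟨ length-++ (shift a σ) ⟩
    length (shift a σ) + length τ  ≡⟨ cong₂ _+_ (trans (length-map (suc a +_) σ) |σ|) |τ| ⟩
    n ∸ a + a                      ≡⟨ m∸n+n≡m a≤n ⟩
    n                              ∎
  shifted-bound : ∀ {y} → y < n ∸ a → suc a + y < suc n
  shifted-bound y<n∸a = s≤s (subst (_ <_) (m+[n∸m]≡n a≤n) (+-monoʳ-< a y<n∸a))

-- The first letter a is never the 2 of a 2-1-3 (its later larger entries all precede its later
-- smaller ones), and the blocks combine by avoids213-++.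
assemble-avoids213 : ∀ a σ τ → All (_< a) τ → Avoids213ᴸ σ → Avoids213ᴸ τ →
  Avoids213ᴸ (assemble a σ τ)
assemble-avoids213 a σ τ τ<a σ-avoids τ-avoids =
  no213Over-++ a (shift a σ) τ (no213Over-above a (shift a σ) (shift-above a σ)) τ<a ,
  avoids213-++ a (shift a σ) τ (shift-above a σ) τ<a (Shift.avoids213⁺ a σ σ-avoids) τ-avoids

-- The descent from the block σ into the block τ is witnessed by the first letter a; if σ is
-- empty the descent from a into τ has no witness, so τ has to be empty as well.
assemble-witnessed : ∀ a σ τ → (σ ≡ [] → τ ≡ []) → All (_< a) τ →
  Witnessed [] σ → Witnessed [] τ → Witnessed [] (assemble a σ τ)
assemble-witnessed a [] τ τ-empty _ _ _ rewrite τ-empty refl = tt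
assemble-witnessed a (y ∷ σ) τ _ τ<a σ-witnessed τ-witnessed =
  (λ y'<a → ⊥-elim (<-asym y'<a (s≤s (m≤m+n a y)))) ,
  witnessed-join (a ∷ []) (suc a + y) (shift a σ) τ a (here refl) (shift-above a (y ∷ σ)) τ<a
    (witnessed-weaken (shift a (y ∷ σ)) (λ ()) (Shift.witnessed⁺ a [] (y ∷ σ) σ-witnessed)) τ-witnessed

decomposition-sound : ∀ {n l} → Decomposition n l → PermList (suc n) l × Good l
decomposition-sound {n} (decomposition a σ τ admissible σ-perm σ-good τ-perm τ-good refl) =
  assemble-perm a≤n σ-perm τ-perm ,
  assemble-avoids213 a σ τ τ<a (proj₁ σ-good) (proj₁ τ-good) ,
  assemble-witnessed a σ τ σ-empty⇒τ-empty τ<a (proj₂ σ-good) (proj₂ τ-good)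
  where
  a≤n : a ≤ n
  a≤n = proj₁ (firstLetters-sound admissible)
  τ<a : All (_< a) τ
  τ<a = proj₁ (proj₂ τ-perm)
  σ-empty⇒τ-empty : σ ≡ [] → τ ≡ []
  σ-empty⇒τ-empty refl =
    length≡0⇒[] (trans (proj₁ τ-perm) (proj₂ (firstLetters-sound admissible) (sym (proj₁ σ-perm))))

HeadNotAbove : ℕ → List ℕ → Set
HeadNotAbove a [] = ⊤
HeadNotAbove a (v ∷ _) = ¬ a < v

spanAbove : ∀ a r → Σ (List ℕ) λ σ' → Σ (List ℕ) λ τ →
  r ≡ σ' ++ τ × All (a <_) σ' × HeadNotAbove a τ
spanAbove a [] = [] , [] , refl , [] , tt
spanAbove a (x ∷ r) with a <? x
... | yes a<x = let (σ' , τ , r≡ , σ'>a , τ-head) = spanAbove a r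
                in x ∷ σ' , τ , cong (x ∷_) r≡ , a<x ∷ σ'>a , τ-head
... | no a≮x = [] , x ∷ r , refl , [] , a≮x

-- Once an entry below a has followed a, 2-1-3-avoidance forbids any later entry above a:
-- everything after the initial run of larger entries lies below a.
rest-below : ∀ a τ → HeadNotAbove a τ → No213Over a τ → All (a ≢_) τ → All (_< a) τ
rest-below a [] _ _ _ = []
rest-below a (v ∷ τ) a≮v (v-ok , _) (a≢v ∷ a∉τ) =
  v<a ∷ All.zipWith (λ (a≮z , a≢z) → ≤∧≢⇒< (≮⇒≥ a≮z) (λ z≡a → a≢z (sym z≡a))) (v-ok v<a , a∉τ)
  where
  v<a : v < a
  v<a = ≤∧≢⇒< (≮⇒≥ a≮v) (λ v≡a → a≢v (sym v≡a))

-- The blocks of a permutation `assemble a σ τ` with τ below a are permutations themselves;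
-- their sizes are forced by the pigeonhole principle.
assemble-perm⁻ : ∀ n a σ τ → All (_< a) τ → PermList (suc n) (assemble a σ τ) →
  a ≤ n × PermList (n ∸ a) σ × PermList a τ
assemble-perm⁻ n a σ τ τ<a (|l| , (a<1+n ∷ rest<1+n) , (_ ∷ rest-unique)) =
  a≤n , (proj₁ sizes , σ<n∸a , σ-unique) , (proj₂ sizes , τ<a , τ-unique)
  where
  open ≡-Reasoning
  a≤n : a ≤ n
  a≤n = ≤-pred a<1+n
  σ-unique : Unique σ
  σ-unique = UniqueP.map⁻ (proj₁ (unique-++⁻ (shift a σ) rest-unique))
  τ-unique : Unique τ
  τ-unique = proj₂ (unique-++⁻ (shift a σ) rest-unique)
  σ<n∸a : All (_< n ∸ a) σ
  σ<n∸a = All.map (λ {y} 1+a+y<1+n → m+n≤o⇒m≤o∸n (suc y) (subst (_≤ n) (cong suc (+-comm a y)) (≤-pred 1+a+y<1+n)))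
                  (AllP.map⁻ (AllP.++⁻ˡ (shift a σ) rest<1+n))
  total : length σ + length τ ≡ n ∸ a + a
  total = begin
    length σ + length τ            ≡⟨ cong (_+ length τ) (sym (length-map (suc a +_) σ)) ⟩
    length (shift a σ) + length τ  ≡⟨ sym (length-++ (shift a σ)) ⟩
    length (shift a σ ++ τ)        ≡⟨ suc-injective |l| ⟩
    n                              ≡⟨ sym (m∸n+n≡m a≤n) ⟩
    n ∸ a + a                      ∎
  sizes : length σ ≡ n ∸ a × length τ ≡ a
  sizes = +-squeeze (unique-bounded-length (n ∸ a) σ σ-unique σ<n∸a)
                    (unique-bounded-length a τ τ-unique τ<a) total

all-ʳ++ : ∀ {P : ℕ → Set} {xs ys} → All P xs → All P ys → All P (xs ʳ++ ys)
all-ʳ++ [] pys = pys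
all-ʳ++ (px ∷ pxs) pys = all-ʳ++ pxs (px ∷ pys)

-- The blocks of a counted `assemble a σ τ` (τ below a) are counted: a lies below all of σ and
-- a, σ lie above all of τ, so neither can witness a descent inside the other block.
assemble-good⁻ : ∀ a σ τ → All (_< a) τ → Good (assemble a σ τ) → Good σ × Good τ
assemble-good⁻ a σ τ τ<a ((_ , avoids) , witnessed) =
  (Shift.avoids213⁻ a σ (proj₁ blocks213) , Shift.witnessed⁻ a [] σ σ'-witnessed) ,
  (proj₂ blocks213 , τ-witnessed)
  where
  σ' : List ℕ
  σ' = shift a σ
  blocks213 : Avoids213ᴸ σ' × Avoids213ᴸ τ
  blocks213 = avoids213-++⁻ σ' τ avoids
  blocksW : Witnessed [] (a ∷ σ') × Witnessed ((a ∷ σ') ʳ++ []) τ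
  blocksW = witnessed-++⁻ [] (a ∷ σ') τ witnessed
  σ'-witnessed : Witnessed [] σ'
  σ'-witnessed = witnessed-drop [] (a ∷ []) σ'
    (inj₂ (All.map (λ a<v v<a → <-asym a<v v<a) (shift-above a σ)) ∷ [])
    (proj₂ (witnessed-++⁻ [] (a ∷ []) σ' (proj₁ blocksW)))
  above-τ : ∀ {w} → a ≤ w → All (λ u → ¬ w < u) τ
  above-τ a≤w = All.map (λ u<a w<u → <-asym (<-≤-trans u<a a≤w) w<u) τ<a
  τ-witnessed : Witnessed [] τ
  τ-witnessed = witnessed-drop [] ((a ∷ σ') ʳ++ []) τ
    (all-ʳ++ (All.map (λ a≤w → inj₁ (above-τ a≤w)) (≤-refl ∷ All.map <⇒≤ (shift-above a σ))) [])
    (proj₂ blocksW)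

-- With no larger block, the descent from a into τ would be unwitnessed; so τ is empty.
no-upper-block : ∀ a τ → All (_< a) τ → Witnessed [] (a ∷ τ) → τ ≡ []
no-upper-block a [] _ _ = refl
no-upper-block a (v ∷ τ) (v<a ∷ _) (descent , _) with descent v<a
... | ()

-- Hence the first letter is admissible: n ∸ a = 0 forces σ = [], so τ = [] and a = |τ| = 0.
first-admissible : ∀ n a σ τ → a ≤ n → PermList (n ∸ a) σ → PermList a τ → All (_< a) τ →
  Witnessed [] (assemble a σ τ) → a ∈ firstLetters n
first-admissible n a [] τ a≤n _ (|τ| , _) τ<a w =
  firstLetters-complete a≤n (λ _ → trans (sym |τ|) (cong length (no-upper-block a τ τ<a w)))
first-admissible n a (_ ∷ _) τ a≤n (|σ| , _) _ _ _ =
  firstLetters-complete a≤n (λ n∸a≡0 → ⊥-elim (1+n≢0 (trans |σ| n∸a≡0)))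

-- Every counted permutation of {0,…,n} decomposes: a is its first letter, σ' its following run
-- of larger entries and τ the rest.
decompose : ∀ n l → PermList (suc n) l → Good l → Decomposition n l
decompose n (a ∷ r) perm@(_ , _ , (a∉r ∷ _)) good with spanAbove a r
... | σ' , τ , refl , σ'>a , τ-head with unshift a σ' σ'>a
... | σ , refl =
  decomposition a σ τ (first-admissible n a σ τ a≤n σ-perm τ-perm τ<a (proj₂ good))
    σ-perm (proj₁ goods) τ-perm (proj₂ goods) refl
  where
  τ<a : All (_< a) τ
  τ<a = rest-below a τ τ-head (proj₂ (no213Over-++⁻ a (shift a σ) τ (proj₁ (proj₁ good))))
                   (AllP.++⁻ʳ (shift a σ) a∉r)
  blocks : a ≤ n × PermList (n ∸ a) σ × PermList a τ
  blocks = assemble-perm⁻ n a σ τ τ<a perm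
  a≤n : a ≤ n
  a≤n = proj₁ blocks
  σ-perm : PermList (n ∸ a) σ
  σ-perm = proj₁ (proj₂ blocks)
  τ-perm : PermList a τ
  τ-perm = proj₂ (proj₂ blocks)
  goods : Good σ × Good τ
  goods = assemble-good⁻ a σ τ τ<a good

map-unique : ∀ {A B : Set} (f : A → B) {xs} → Unique xs →
  (∀ {x y} → x ∈ xs → y ∈ xs → f x ≡ f y → x ≡ y) → Unique (map f xs)
map-unique f {[]} _ _ = []
map-unique f {x ∷ xs} (x∉xs ∷ xs-unique) f-inj =
  AllP.map⁺ (All.tabulate (λ y∈xs fx≡fy → All.lookup x∉xs y∈xs (f-inj (here refl) (there y∈xs) fx≡fy))) ∷
  map-unique f xs-unique (λ x∈ y∈ → f-inj (there x∈) (there y∈))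

cartesianProductWith-unique : ∀ {A B C : Set} (f : A → B → C) {xs ys} → Unique xs → Unique ys →
  (∀ {x x' y y'} → x ∈ xs → x' ∈ xs → y ∈ ys → y' ∈ ys → f x y ≡ f x' y' → x ≡ x' × y ≡ y') →
  Unique (cartesianProductWith f xs ys)
cartesianProductWith-unique f {[]} _ _ _ = []
cartesianProductWith-unique f {x ∷ xs} {ys} (x∉xs ∷ xs-unique) ys-unique f-inj =
  UniqueP.++⁺ (map-unique (f x) ys-unique (λ y∈ y'∈ eq → proj₂ (f-inj (here refl) (here refl) y∈ y'∈ eq)))
              (cartesianProductWith-unique f xs-unique ys-unique (λ x∈ x'∈ → f-inj (there x∈) (there x'∈)))
              disjoint
  where
  disjoint : ∀ {v} → ¬ (v ∈ map (f x) ys × v ∈ cartesianProductWith f xs ys)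
  disjoint (v∈row , v∈rest) with ∈-map⁻ (f x) v∈row | ∈-cartesianProductWith⁻ f xs ys v∈rest
  ... | y , y∈ys , refl | x' , y' , x'∈xs , y'∈ys , eq =
    All.lookup x∉xs x'∈xs (proj₁ (f-inj (here refl) (there x'∈xs) y∈ys y'∈ys eq))

concatMap-unique : ∀ {A B : Set} (g : A → List B) {xs} → Unique xs → (∀ {x} → x ∈ xs → Unique (g x)) →
  (∀ {x x' z} → x ∈ xs → x' ∈ xs → z ∈ g x → z ∈ g x' → x ≡ x') → Unique (concatMap g xs)
concatMap-unique g {[]} _ _ _ = []
concatMap-unique g {x ∷ xs} (x∉xs ∷ xs-unique) g-unique separated =
  UniqueP.++⁺ (g-unique (here refl))
    (concatMap-unique g xs-unique (λ x∈ → g-unique (there x∈)) (λ x∈ x'∈ → separated (there x∈) (there x'∈)))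
    (λ (z∈gx , z∈rest) →
       let (x' , x'∈xs , z∈gx') = find (∈-concatMap⁻ g z∈rest)
       in All.lookup x∉xs x'∈xs (separated (here refl) (there x'∈xs) z∈gx z∈gx'))

length-concatMap : ∀ {A B : Set} (g : A → List B) xs →
  length (concatMap g xs) ≡ sum (map (λ x → length (g x)) xs)
length-concatMap g [] = refl
length-concatMap g (x ∷ xs) = trans (length-++ (g x)) (cong (length (g x) +_) (length-concatMap g xs))

length-cartesianProductWith : ∀ {A B C : Set} (f : A → B → C) xs ys →
  length (cartesianProductWith f xs ys) ≡ length xs * length ys
length-cartesianProductWith f [] ys = refl
length-cartesianProductWith f (x ∷ xs) ys =
  trans (length-++ (map (f x) ys)) (cong₂ _+_ (length-map (f x) ys) (length-cartesianProductWith f xs ys))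

++-split-at : ∀ a x₁ y₁ x₂ y₂ → All (a <_) x₁ → All (_< a) y₁ → All (a <_) x₂ → All (_< a) y₂ →
  x₁ ++ y₁ ≡ x₂ ++ y₂ → x₁ ≡ x₂
++-split-at a [] _ [] _ _ _ _ _ _ = refl
++-split-at a [] [] (_ ∷ _) _ _ _ _ _ ()
++-split-at a [] (v ∷ _) (w ∷ _) _ _ (v<a ∷ _) (a<w ∷ _) _ eq =
  ⊥-elim (<-asym v<a (subst (a <_) (sym (∷-injectiveˡ eq)) a<w))
++-split-at a (w ∷ _) _ [] [] _ _ _ _ ()
++-split-at a (w ∷ _) _ [] (v ∷ _) (a<w ∷ _) _ _ (v<a ∷ _) eq =
  ⊥-elim (<-asym v<a (subst (a <_) (∷-injectiveˡ eq) a<w))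
++-split-at a (w ∷ x₁) y₁ (w' ∷ x₂) y₂ (_ ∷ x₁>a) y₁<a (_ ∷ x₂>a) y₂<a eq =
  cong₂ _∷_ (∷-injectiveˡ eq) (++-split-at a x₁ y₁ x₂ y₂ x₁>a y₁<a x₂>a y₂<a (∷-injectiveʳ eq))

assemble-injective : ∀ a {σ σ' τ τ'} → All (_< a) τ → All (_< a) τ' →
  assemble a σ τ ≡ assemble a σ' τ' → σ ≡ σ' × τ ≡ τ'
assemble-injective a {σ} {σ'} {τ} {τ'} τ<a τ'<a eq = σ≡σ' , τ≡τ'
  where
  σ≡σ' : σ ≡ σ'
  σ≡σ' = map-injective (λ {x} {y} → +-cancelˡ-≡ (suc a) x y)
           (++-split-at a _ τ _ τ' (shift-above a σ) τ<a (shift-above a σ') τ'<a (∷-injectiveʳ eq))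
  τ≡τ' : τ ≡ τ'
  τ≡τ' = ++-cancelˡ (shift a σ) τ τ' (trans (∷-injectiveʳ eq) (cong (λ s → shift a s ++ τ') (sym σ≡σ')))

block : ℕ → (ℕ → List (List ℕ)) → ℕ → List (List ℕ)
block n G a = cartesianProductWith (assemble a) (G (n ∸ a)) (G a)

assembleAll : ℕ → (ℕ → List (List ℕ)) → List (List ℕ)
assembleAll n G = concatMap (block n G) (firstLetters n)

Enumerates : ℕ → List (List ℕ) → Set
Enumerates n G = Unique G × (∀ l → l ∈ G ⇔ (PermList n l × Good l))

block-first : ∀ n G {a z} → z ∈ block n G a → Σ (List ℕ) λ r → z ≡ a ∷ r
block-first n G {a} z∈ =
  let (σ , τ , _ , _ , z≡) = ∈-cartesianProductWith⁻ (assemble a) (G (n ∸ a)) (G a) z∈ in _ , z≡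

assembleAll-enumerates : ∀ n G →
  (∀ {a} → a ∈ firstLetters n → Enumerates (n ∸ a) (G (n ∸ a)) × Enumerates a (G a)) →
  Enumerates (suc n) (assembleAll n G)
assembleAll-enumerates n G blocks-enumerate = unique , λ l → mk⇔ (sound l) (complete l)
  where
  open Equivalence
  upper : ∀ {a} → a ∈ firstLetters n → Enumerates (n ∸ a) (G (n ∸ a))
  upper a∈ = proj₁ (blocks-enumerate a∈)
  lower : ∀ {a} → a ∈ firstLetters n → Enumerates a (G a)
  lower a∈ = proj₂ (blocks-enumerate a∈)
  lower-bound : ∀ {a τ} (a∈ : a ∈ firstLetters n) → τ ∈ G a → All (_< a) τ
  lower-bound a∈ τ∈ = proj₁ (proj₂ (proj₁ (to (proj₂ (lower a∈) _) τ∈)))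
  unique : Unique (assembleAll n G)
  unique = concatMap-unique (block n G) (firstLetters-unique n)
    (λ a∈ → cartesianProductWith-unique (assemble _) (proj₁ (upper a∈)) (proj₁ (lower a∈))
              (λ _ _ τ∈ τ'∈ → assemble-injective _ (lower-bound a∈ τ∈) (lower-bound a∈ τ'∈)))
    (λ _ _ z∈ z∈' → ∷-injectiveˡ (trans (sym (proj₂ (block-first n G z∈))) (proj₂ (block-first n G z∈'))))
  sound : ∀ l → l ∈ assembleAll n G → PermList (suc n) l × Good l
  sound l l∈ =
    let (a , a∈ , l∈block) = find (∈-concatMap⁻ (block n G) l∈)
        (σ , τ , σ∈ , τ∈ , l≡) = ∈-cartesianProductWith⁻ (assemble a) (G (n ∸ a)) (G a) l∈block
        (σ-perm , σ-good) = to (proj₂ (upper a∈) σ) σ∈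
        (τ-perm , τ-good) = to (proj₂ (lower a∈) τ) τ∈
    in decomposition-sound (decomposition a σ τ a∈ σ-perm σ-good τ-perm τ-good l≡)
  complete : ∀ l → PermList (suc n) l × Good l → l ∈ assembleAll n G
  complete l (perm , good) with decompose n l perm good
  ... | decomposition a σ τ a∈ σ-perm σ-good τ-perm τ-good refl =
    ∈-concatMap⁺ (block n G) (lose a∈ (∈-cartesianProductWith⁺ (assemble a)
      (from (proj₂ (upper a∈) σ) (σ-perm , σ-good)) (from (proj₂ (lower a∈) τ) (τ-perm , τ-good))))

-- The enumeration, by recursion on the size with fuel (fuel ≥ n suffices).
goodPerms : (fuel n : ℕ) → List (List ℕ)
goodPerms _ zero = [] ∷ []
goodPerms zero (suc n) = []
goodPerms (suc fuel) (suc n) = assembleAll n (goodPerms fuel)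

goodPerms-enumerates : ∀ fuel n → n ≤ fuel → Enumerates n (goodPerms fuel n)
goodPerms-enumerates fuel zero _ =
  ([] ∷ []) ,
  λ l → mk⇔ (λ { (here refl) → (refl , [] , []) , tt , tt }) (λ ((|l| , _) , _) → here (length≡0⇒[] |l|))
goodPerms-enumerates (suc fuel) (suc n) (s≤s n≤fuel) =
  assembleAll-enumerates n (goodPerms fuel) λ {a} a∈ →
    goodPerms-enumerates fuel _ (≤-trans (m∸n≤m n a) n≤fuel) ,
    goodPerms-enumerates fuel _ (≤-trans (proj₁ (firstLetters-sound a∈)) n≤fuel)

motzkinList-unfold : ∀ n → motzkinList n ≡ motzkin n ∷ map motzkin (downFrom n)
motzkinList-unfold zero = refl
motzkinList-unfold (suc n) rewrite motzkinList-unfold n = refl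

-- Re-indexing lemmas turning the convolution in Defs into a sum over i < m.
applyDownFrom-applyUpTo : ∀ (f : ℕ → ℕ) m → applyDownFrom f m ≡ applyUpTo (λ i → f (m ∸ suc i)) m
applyDownFrom-applyUpTo f zero = refl
applyDownFrom-applyUpTo f (suc m) = cong (f m ∷_) (applyDownFrom-applyUpTo f m)

zipWith-applyUpTo : ∀ (g h : ℕ → ℕ) m →
  zipWith _*_ (applyUpTo g m) (applyUpTo h m) ≡ applyUpTo (λ i → g i * h i) m
zipWith-applyUpTo g h zero = refl
zipWith-applyUpTo g h (suc m) = cong (g 0 * h 0 ∷_) (zipWith-applyUpTo (λ i → g (suc i)) (λ i → h (suc i)) m)

motzkin-suc : ∀ m →
  motzkin (suc m) ≡ motzkin m + sum (applyUpTo (λ i → motzkin (m ∸ suc i) * motzkin i) m)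
motzkin-suc m = begin
  motzkin (suc m)
    ≡⟨ ∷-injectiveˡ (trans (sym (motzkinList-unfold (suc m))) unfold-step) ⟩
  motzkin m + sum (zipWith _*_ R (reverse R))
    ≡⟨ cong (λ z → motzkin m + sum z) (cong₂ (zipWith _*_) R≡ reverse-R≡) ⟩
  motzkin m + sum (zipWith _*_ (applyUpTo (λ i → motzkin (m ∸ suc i)) m) (applyUpTo motzkin m))
    ≡⟨ cong (λ z → motzkin m + sum z) (zipWith-applyUpTo (λ i → motzkin (m ∸ suc i)) motzkin m) ⟩
  motzkin m + sum (applyUpTo (λ i → motzkin (m ∸ suc i) * motzkin i) m)
    ∎
  where
  open ≡-Reasoning
  R : List ℕ
  R = map motzkin (downFrom m)
  unfold-step : motzkinList (suc m) ≡ (motzkin m + sum (zipWith _*_ R (reverse R))) ∷ motzkin m ∷ R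
  unfold-step rewrite motzkinList-unfold m = refl
  R≡ : R ≡ applyUpTo (λ i → motzkin (m ∸ suc i)) m
  R≡ = trans (map-downFrom motzkin m) (applyDownFrom-applyUpTo motzkin m)
  reverse-R≡ : reverse R ≡ applyUpTo motzkin m
  reverse-R≡ = begin
    reverse R                          ≡⟨ sym (reverse-map motzkin (downFrom m)) ⟩
    map motzkin (reverse (downFrom m)) ≡⟨ cong (map motzkin) (reverse-downFrom m) ⟩
    map motzkin (upTo m)               ≡⟨ map-upTo motzkin m ⟩
    applyUpTo motzkin m                ∎

sum-applyUpTo-cong : ∀ (g h : ℕ → ℕ) m → (∀ i → i < m → g i ≡ h i) →
  sum (applyUpTo g m) ≡ sum (applyUpTo h m)
sum-applyUpTo-cong g h zero _ = refl
sum-applyUpTo-cong g h (suc m) g≡h =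
  cong₂ _+_ (g≡h 0 (s≤s z≤n))
            (sum-applyUpTo-cong (λ i → g (suc i)) (λ i → h (suc i)) m (λ i i<m → g≡h (suc i) (s≤s i<m)))

assembleAll-length : ∀ n G →
  length (assembleAll n G) ≡ sum (map (λ a → length (G (n ∸ a)) * length (G a)) (firstLetters n))
assembleAll-length n G =
  trans (length-concatMap (block n G) (firstLetters n))
        (cong sum (map-cong (λ a → length-cartesianProductWith (assemble a) (G (n ∸ a)) (G a)) (firstLetters n)))

-- There are M_k counted permutations of {0,…,k}: the block counts satisfy the Motzkin recurrence.
goodPerms-count : ∀ fuel k → suc k ≤ fuel → length (goodPerms fuel (suc k)) ≡ motzkin k
goodPerms-count (suc fuel) k (s≤s k≤fuel) = trans (assembleAll-length k (goodPerms fuel)) (count k k≤fuel)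
  where
  c : ℕ → ℕ
  c j = length (goodPerms fuel j)
  count : ∀ j → j ≤ fuel → sum (map (λ a → c (j ∸ a) * c a) (firstLetters j)) ≡ motzkin j
  count zero _ = refl
  count (suc m) 1+m≤fuel = begin
    sum (map h (upTo (suc m)))
      ≡⟨ cong sum (map-upTo h (suc m)) ⟩
    c (suc m) * 1 + sum (applyUpTo (λ i → h (suc i)) m)
      ≡⟨ cong₂ _+_ (trans (*-identityʳ _) (goodPerms-count fuel m 1+m≤fuel))
                   (sum-applyUpTo-cong _ _ m term) ⟩
    motzkin m + sum (applyUpTo (λ i → motzkin (m ∸ suc i) * motzkin i) m)
      ≡⟨ sym (motzkin-suc m) ⟩
    motzkin (suc m)
      ∎
    where
    open ≡-Reasoning
    h : ℕ → ℕ
    h a = c (suc m ∸ a) * c a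
    -- the first letter suc i leaves blocks of sizes m ∸ i = suc (m ∸ suc i) and suc i
    term : ∀ i → i < m → h (suc i) ≡ motzkin (m ∸ suc i) * motzkin i
    term i i<m = cong₂ _*_
      (trans (cong c (+-∸-assoc 1 i<m))
             (goodPerms-count fuel (m ∸ suc i) (≤-trans (s≤s (m∸n≤m m (suc i))) 1+m≤fuel)))
      (goodPerms-count fuel i (≤-trans (s≤s (<⇒≤ i<m)) 1+m≤fuel))

values : ∀ {N k} → Vec (Fin N) k → List ℕ
values v = map toℕ (toList v)

length-values : ∀ {N k} (v : Vec (Fin N) k) → length (values v) ≡ k
length-values v = trans (length-map toℕ (toList v)) (length-toList v)

all-values⁺ : ∀ {P : ℕ → Set} {N k} (v : Vec (Fin N) k) → (∀ i → P (toℕ (lookup v i))) → All P (values v)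
all-values⁺ [] _ = []
all-values⁺ (x ∷ v) p = p Fin.zero ∷ all-values⁺ v (λ i → p (Fin.suc i))

all-values⁻ : ∀ {P : ℕ → Set} {N k} (v : Vec (Fin N) k) → All P (values v) → ∀ i → P (toℕ (lookup v i))
all-values⁻ (x ∷ v) (px ∷ _) Fin.zero = px
all-values⁻ (x ∷ v) (_ ∷ pv) (Fin.suc i) = all-values⁻ v pv i

injective⇒unique : ∀ {N k} (v : Vec (Fin N) k) → Injective _≡_ _≡_ (lookup v) → Unique (values v)
injective⇒unique [] _ = []
injective⇒unique (x ∷ v) inj =
  all-values⁺ v (λ i x≡vᵢ → FinP.0≢1+n (inj {Fin.zero} {Fin.suc i} (toℕ-injective x≡vᵢ))) ∷
  injective⇒unique v (λ e → FinP.suc-injective (inj e))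

unique⇒injective : ∀ {N k} (v : Vec (Fin N) k) → Unique (values v) → Injective _≡_ _≡_ (lookup v)
unique⇒injective (x ∷ v) _ {Fin.zero} {Fin.zero} _ = refl
unique⇒injective (x ∷ v) (x∉v ∷ _) {Fin.zero} {Fin.suc j} e = ⊥-elim (all-values⁻ v x∉v j (cong toℕ e))
unique⇒injective (x ∷ v) (x∉v ∷ _) {Fin.suc i} {Fin.zero} e = ⊥-elim (all-values⁻ v x∉v i (cong toℕ (sym e)))
unique⇒injective (x ∷ v) (_ ∷ v-unique) {Fin.suc i} {Fin.suc j} e = cong Fin.suc (unique⇒injective v v-unique e)

-- Avoids213 of Defs, for vectors of any length (needed to recurse on the tail).
Avoids213ᵛ : ∀ {N k} → Vec (Fin N) k → Set
Avoids213ᵛ {k = k} π = ∀ (i j l : Fin k) → i Fin.< j → j Fin.< l →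
  ¬ (lookup π j Fin.< lookup π i × lookup π i Fin.< lookup π l)

No213Overᵛ : ∀ {N k} → Fin N → Vec (Fin N) k → Set
No213Overᵛ {k = k} x w = ∀ (j l : Fin k) → j Fin.< l → ¬ (lookup w j Fin.< x × x Fin.< lookup w l)

no213Over-values⁺ : ∀ {N k} (x : Fin N) (w : Vec (Fin N) k) → No213Overᵛ x w → No213Over (toℕ x) (values w)
no213Over-values⁺ x [] _ = tt
no213Over-values⁺ x (y ∷ w) none =
  (λ y<x → all-values⁺ w (λ l x<z → none Fin.zero (Fin.suc l) (s≤s z≤n) (y<x , x<z))) ,
  no213Over-values⁺ x w (λ j l j<l → none (Fin.suc j) (Fin.suc l) (s≤s j<l))

no213Over-values⁻ : ∀ {N k} (x : Fin N) (w : Vec (Fin N) k) → No213Over (toℕ x) (values w) → No213Overᵛ x w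
no213Over-values⁻ x (y ∷ w) (y-ok , _) Fin.zero (Fin.suc l) _ (y<x , x<z) = all-values⁻ w (y-ok y<x) l x<z
no213Over-values⁻ x (y ∷ w) (_ , rest) (Fin.suc j) (Fin.suc l) j<l = no213Over-values⁻ x w rest j l (≤-pred j<l)

avoids213-values⁺ : ∀ {N k} (π : Vec (Fin N) k) → Avoids213ᵛ π → Avoids213ᴸ (values π)
avoids213-values⁺ [] _ = tt
avoids213-values⁺ (x ∷ w) none =
  no213Over-values⁺ x w (λ j l j<l → none Fin.zero (Fin.suc j) (Fin.suc l) (s≤s z≤n) (s≤s j<l)) ,
  avoids213-values⁺ w (λ i j l i<j j<l → none (Fin.suc i) (Fin.suc j) (Fin.suc l) (s≤s i<j) (s≤s j<l))

avoids213-values⁻ : ∀ {N k} (π : Vec (Fin N) k) → Avoids213ᴸ (values π) → Avoids213ᵛ π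
avoids213-values⁻ (x ∷ w) (x-ok , _) Fin.zero (Fin.suc j) (Fin.suc l) _ j<l =
  no213Over-values⁻ x w x-ok j l (≤-pred j<l)
avoids213-values⁻ (x ∷ w) (_ , rest) (Fin.suc i) (Fin.suc j) (Fin.suc l) i<j j<l =
  avoids213-values⁻ w rest i j l (≤-pred i<j) (≤-pred j<l)

-- AvoidsBar2-31 of Defs for vectors of any length, where a descent may also be witnessed by
-- the list s of values read before the vector.
WitnessedBarᵛ : ∀ {N k} → List ℕ → Vec (Fin N) k → Set
WitnessedBarᵛ {k = k} s π = ∀ (i i' : Fin k) → toℕ i' ≡ suc (toℕ i) → lookup π i' Fin.< lookup π i →
  Any (Between (toℕ (lookup π i')) (toℕ (lookup π i))) s
  ⊎ ∃[ j ] (j Fin.< i × lookup π j Fin.< lookup π i × lookup π i' Fin.< lookup π j)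

-- Reading one more letter moves it from the vector into the witness list.
witnessed-values⁺ : ∀ {N k} s (π : Vec (Fin N) k) → WitnessedBarᵛ s π → Witnessed s (values π)
witnessed-values⁺ s [] _ = tt
witnessed-values⁺ s (x ∷ []) _ = tt
witnessed-values⁺ s (x ∷ y ∷ w) bar = first-descent , witnessed-values⁺ (toℕ x ∷ s) (y ∷ w) rest
  where
  first-descent : toℕ y < toℕ x → Any (Between (toℕ y) (toℕ x)) s
  first-descent y<x with bar Fin.zero (Fin.suc Fin.zero) refl y<x
  ... | inj₁ witness = witness
  ... | inj₂ (_ , () , _)
  rest : WitnessedBarᵛ (toℕ x ∷ s) (y ∷ w)
  rest i i' i'≡ descent with bar (Fin.suc i) (Fin.suc i') (cong suc i'≡) descent
  ... | inj₁ witness = inj₁ (there witness)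
  ... | inj₂ (Fin.zero , _ , below , above) = inj₁ (here (above , below))
  ... | inj₂ (Fin.suc j , j<i , below , above) = inj₂ (j , ≤-pred j<i , below , above)

witnessed-values⁻ : ∀ {N k} s (π : Vec (Fin N) k) → Witnessed s (values π) → WitnessedBarᵛ s π
witnessed-values⁻ s (x ∷ y ∷ w) (first-descent , _) Fin.zero (Fin.suc Fin.zero) _ y<x = inj₁ (first-descent y<x)
witnessed-values⁻ s (x ∷ y ∷ w) (_ , rest) (Fin.suc i) (Fin.suc i') i'≡ descent
  with witnessed-values⁻ (toℕ x ∷ s) (y ∷ w) rest i i' (suc-injective i'≡) descent
... | inj₁ (here (above , below)) = inj₂ (Fin.zero , s≤s z≤n , below , above)
... | inj₁ (there witness) = inj₁ witness
... | inj₂ (j , j<i , below , above) = inj₂ (Fin.suc j , s≤s j<i , below , above)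

-- Reads a list of naturals back as a vector of length k over Fin (M+1); entries are reduced
-- mod M+1 and missing entries are 0, neither of which happens for permutation lists.
fromValues : ∀ {M} k → List ℕ → Vec (Fin (suc M)) k
fromValues zero _ = []
fromValues (suc k) [] = Fin.zero ∷ fromValues k []
fromValues {M} (suc k) (x ∷ l) = (x mod suc M) ∷ fromValues k l

toℕ-mod : ∀ {M x} → x < suc M → toℕ (x mod suc M) ≡ x
toℕ-mod {M} {x} x<1+M = trans (toℕ-fromℕ< _) (m<n⇒m%n≡m x<1+M)

values-fromValues : ∀ {M} k l → length l ≡ k → All (_< suc M) l → values (fromValues {M} k l) ≡ l
values-fromValues zero [] _ _ = refl
values-fromValues (suc k) (x ∷ l) |l| (x< ∷ l<) = cong₂ _∷_ (toℕ-mod x<) (values-fromValues k l (suc-injective |l|) l<)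

fromValues-values : ∀ {M k} (v : Vec (Fin (suc M)) k) → fromValues k (values v) ≡ v
fromValues-values [] = refl
fromValues-values (y ∷ v) = cong₂ _∷_ (toℕ-injective (toℕ-mod (toℕ<n y))) (fromValues-values v)

characterisation : ∀ {n} (π : Vec (Fin n) n) →
  (IsPermutation π × Avoids213 π × AvoidsBar2-31 π) ⇔ (PermList n (values π) × Good (values π))
characterisation π = mk⇔
  (λ (injective , avoids , bar) →
     (length-values π , all-values⁺ π (λ i → toℕ<n (lookup π i)) , injective⇒unique π injective) ,
     avoids213-values⁺ π avoids , witnessed-values⁺ [] π (λ i i' i'≡ descent → inj₂ (bar i i' i'≡ descent)))
  (λ ((_ , _ , unique) , avoids , witnessed) →
     unique⇒injective π unique , avoids213-values⁻ π avoids ,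
     λ i i' i'≡ descent → [ (λ ()) , id ]′ (witnessed-values⁻ [] π witnessed i i' i'≡ descent))

vectorEnumeration : ∀ {M G} → Enumerates (suc M) G →
  Σ (List (Vec (Fin (suc M)) (suc M))) λ L →
    Unique L
    × (∀ π → (π ∈ L) ⇔ (IsPermutation π × Avoids213 π × AvoidsBar2-31 π))
    × length L ≡ length G
vectorEnumeration {M} {G} (G-unique , G-spec) =
  map decode G , map-unique decode G-unique decode-injective , membership , length-map decode G
  where
  open Equivalence
  decode : List ℕ → Vec (Fin (suc M)) (suc M)
  decode = fromValues (suc M)
  round-trip : ∀ {l} → l ∈ G → values (decode l) ≡ l
  round-trip {l} l∈ = let ((|l| , l< , _) , _) = to (G-spec l) l∈ in values-fromValues (suc M) l |l| l<
  decode-injective : ∀ {l l'} → l ∈ G → l' ∈ G → decode l ≡ decode l' → l ≡ l'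
  decode-injective l∈ l'∈ eq = trans (sym (round-trip l∈)) (trans (cong values eq) (round-trip l'∈))
  membership : ∀ π → (π ∈ map decode G) ⇔ (IsPermutation π × Avoids213 π × AvoidsBar2-31 π)
  membership π = mk⇔
    (λ π∈ → let (l , l∈ , π≡) = ∈-map⁻ decode π∈
            in from (characterisation π)
                 (subst (λ l' → PermList (suc M) l' × Good l') (sym (trans (cong values π≡) (round-trip l∈)))
                        (to (G-spec l) l∈)))
    (λ props → subst (_∈ map decode G) (fromValues-values π)
                     (∈-map⁺ decode (from (G-spec (values π)) (to (characterisation π) props))))

proposition2p1 : ∀ (n : ℕ) → 1 ≤ n →
    Σ (List (Vec (Fin n) n)) λ L →
      Unique L
      × (∀ (π : Vec (Fin n) n) → (π ∈ L) ⇔ (IsPermutation π × Avoids213 π × AvoidsBar2-31 π))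
      × length L ≡ motzkin (n ∸ 1)
proposition2p1 (suc m) _ =
  let (L , L-unique , L-spec , |L|) = vectorEnumeration (goodPerms-enumerates (suc m) (suc m) ≤-refl)
  in L , L-unique , L-spec , trans |L| (goodPerms-count (suc m) m ≤-refl)
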